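{- Let $a_1,\dots,a_n$ be pairwise coprime positive integers, $\mathcal{T}=[0,a_1]\times\cdots\times[0,a_n]$, and let $v\in\mathcal{T}\cap\mathbb{N}^n$ be a point that is not a corner. Let $I(v)=\{i\in[n]: v_i=0 \text{ or } v_i=a_i\}$. Then $m_{\mathcal{T}}(v)\le 2^{\,n-1-|I(v)|}$.
   Context: A corner of $\mathcal{T}$ is a point $w$ with $w_i\in\{0,a_i\}$ for all $i$. The billiard trajectory is the curve $\gamma$ starting at the origin with direction $d=(1,\dots,1)$, moving in a straight line; whenever it reaches the boundary hyperplane $x_i=0$ or $x_i=a_i$, the $i$-th component of its current direction is negated (several components simultaneously if several such hyperplanes are reached at once), and the motion stops when it reaches a corner other than the origin. Parametrize $\gamma:[0,L]\to\mathcal{T}$ so that on each linear piece $\gamma'(t)\in\{ -1,1\}^n$. The crossing number $m_{\mathcal{T}}(v)$ is the number of parameters $t\in[0,L]$ with $\gamma(t)=v$. Here $\mathbb{N}$ includes $0$. -}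

module Defs where

open import Data.Nat using (ℕ; zero; suc; _∸_; _<_; _≟_)
open import Data.Bool using (Bool; true; false; not; if_then_else_)
open import Data.Fin using (Fin)
open import Data.Vec using (Vec; lookup; tabulate; replicate; zipWith)
open import Data.Vec.Properties using (≡-dec)
open import Data.List using (List; length; filter; upTo; allFin)
open import Data.Product using (_×_; _,_; proj₁; proj₂)
open import Data.Sum using (_⊎_)
open import Relation.Nullary using (¬_; Dec; yes; no)
open import Relation.Nullary.Decidable using (_⊎-dec_; ⌊_⌋)
open import Relation.Binary.PropositionalEquality using (_≡_)

-- A state of the (discretised) billiard: current position and current
-- direction (true = +1, false = -1) in each coordinate.
State : ℕ → Set
State n = Vec ℕ n × Vec Bool n

movePos : ℕ → Bool → ℕ
movePos p true  = suc p
movePos p false = p ∸ 1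

atWall : ℕ → ℕ → Bool
atWall a p = ⌊ (p ≟ 0) ⊎-dec (p ≟ a) ⌋

step : ∀ {n} → Vec ℕ n → State n → State n
step a (p , d) =
  let p' = zipWith movePos p d in
  p' , tabulate (λ i → if atWall (lookup a i) (lookup p' i)
                        then not (lookup d i) else lookup d i)

state : ∀ {n} → Vec ℕ n → ℕ → State n
state a zero    = replicate _ 0 , replicate _ true
state a (suc t) = step a (state a t)

γ : ∀ {n} → Vec ℕ n → ℕ → Vec ℕ n
γ a t = proj₁ (state a t)

IsCorner : ∀ {n} → Vec ℕ n → Vec ℕ n → Set
IsCorner {n} a w = ∀ (i : Fin n) → (lookup w i ≡ 0) ⊎ (lookup w i ≡ lookup a i)

IsStopTime : ∀ {n} → Vec ℕ n → ℕ → Set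
IsStopTime a L =
  (0 < L) × IsCorner a (γ a L) × (∀ t → 0 < t → t < L → ¬ IsCorner a (γ a t))

-- crossing number: number of times t ∈ [0, L] with γ(t) = v
-- (integer points are only visited at integer times, as all speeds are ±1)
crossing : ∀ {n} → Vec ℕ n → ℕ → Vec ℕ n → ℕ
crossing a L v = length (filter (λ t → ≡-dec _≟_ (γ a t) v) (upTo (suc L)))

cardI : ∀ {n} → Vec ℕ n → Vec ℕ n → ℕ
cardI {n} a v =
  length (filter (λ i → (lookup v i ≟ 0) ⊎-dec (lookup v i ≟ lookup a i)) (allFin n))

-- In coordinate i the trajectory is the one-dimensional billiard in [0, aᵢ]:
-- its position and heading at time t determine, and are determined by, the
-- phase t mod 2aᵢ.  So if γ(t) = γ(t') = v, then in each interior coordinate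
-- the phases are equal when the headings agree and opposite mod 2aᵢ when they
-- differ; on a wall coordinate both hold.  Fix an interior coordinate j and
-- record, for every other interior coordinate, whether its heading agrees with
-- that of j; this signature takes at most 2^(n-1-|I(v)|) values.  Two visits
-- with the same signature have all phases equal or all opposite, so every 2aᵢ
-- divides t' - t, resp. t + t'; half of it is a common multiple of the aᵢ,
-- hence a time at which γ is at a corner, and it lies strictly between 0 and L
-- unless t = t'.
module Submission where

open import Defs
open import Data.Bool as Bool using (Bool; true; false; not; if_then_else_; _xor_)
open import Data.Bool.Properties using (xor-same; xor-comm)
open import Data.Empty using (⊥; ⊥-elim)
open import Data.Fin using (Fin; zero; suc; funToFin; finToFun)
open import Data.Fin.Properties using (2↔Bool; finToFun-funToFin; injective⇒≤)
open import Data.List as List using (List; []; _∷_; length; filter; upTo; allFin)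
open import Data.List.Properties using (length-tabulate)
open import Data.List.Membership.Propositional using (_∈_)
open import Data.List.Membership.Propositional.Properties
  using (∈-lookup; ∈-filter⁺; ∈-filter⁻; ∈-upTo⁻; ∈-allFin)
open import Data.List.Relation.Unary.All as All using ()
open import Data.List.Relation.Unary.AllPairs using (_∷_)
open import Data.List.Relation.Unary.Any as Any using (here; there)
open import Data.List.Relation.Unary.Any.Properties using (lookup-index)
open import Data.List.Relation.Unary.Unique.Propositional using (Unique)
open import Data.List.Relation.Unary.Unique.Propositional.Properties using (filter⁺; upTo⁺)
open import Data.Nat
open import Data.Nat.Coprimality using (Coprime)
open import Data.Nat.DivMod
open import Data.Nat.Divisibility
open import Data.Nat.Properties
open import Data.Product using (_×_; _,_; proj₁; proj₂)
open import Data.Sum as Sum using (_⊎_; inj₁; inj₂)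
open import Data.Vec using (Vec; lookup; zipWith)
open import Data.Vec.Properties using (≡-dec; lookup-zipWith; lookup∘tabulate; lookup-replicate)
open import Function using (_∘_; id)
open import Function.Bundles using (Inverse)
open import Relation.Binary.PropositionalEquality
open import Relation.Nullary using (¬_; yes; no; contradiction)
open import Relation.Nullary.Decidable using (_⊎-dec_)
open import Relation.Nullary.Reflects using (ofʸ; ofⁿ)
open import Relation.Unary using (Decidable)
open import Relation.Unary.Properties using (∁?)

%-≡⇒∣∸ : ∀ m n {d} .{{_ : NonZero d}} → m % d ≡ n % d → d ∣ n ∸ m
%-≡⇒∣∸ m n {d} m≡n = divides (n / d ∸ m / d) (begin
  n ∸ m                                     ≡⟨ cong₂ _∸_ (m≡m%n+[m/n]*n n d) (m≡m%n+[m/n]*n m d) ⟩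
  (n % d + n / d * d) ∸ (m % d + m / d * d) ≡⟨ cong (λ r → (r + n / d * d) ∸ (m % d + m / d * d)) (sym m≡n) ⟩
  (m % d + n / d * d) ∸ (m % d + m / d * d) ≡⟨ [m+n]∸[m+o]≡n∸o (m % d) _ _ ⟩
  n / d * d ∸ m / d * d                     ≡⟨ *-distribʳ-∸ d (n / d) (m / d) ⟨
  (n / d ∸ m / d) * d                       ∎)
  where open ≡-Reasoning

∣%+%⇒∣+ : ∀ m n {d} .{{_ : NonZero d}} → d ∣ m % d + n % d → d ∣ m + n
∣%+%⇒∣+ m n {d} d∣sum = m%n≡0⇒n∣m (m + n) d (trans (%-distribˡ-+ m n d) (n∣m⇒m%n≡0 _ d d∣sum))

m+[1+n]≡o⇒n≡o∸1∸m : ∀ {m n o} → m + suc n ≡ o → n ≡ o ∸ 1 ∸ m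
m+[1+n]≡o⇒n≡o∸1∸m {m} {n} refl = trans (sym (m+n∸m≡n m n)) (cong (λ k → k ∸ 1 ∸ m) (sym (+-suc m n)))

xor-cancelʳ : ∀ x y z → x xor z ≡ y xor z → x ≡ y
xor-cancelʳ false false _     _ = refl
xor-cancelʳ true  true  _     _ = refl
xor-cancelʳ false true  false ()
xor-cancelʳ false true  true  ()
xor-cancelʳ true  false false ()
xor-cancelʳ true  false true  ()

bitsToFin : ∀ {m} → (Fin m → Bool) → Fin (2 ^ m)
bitsToFin f = funToFin (Inverse.from 2↔Bool ∘ f)

bitsToFin-injective : ∀ {m} {f g : Fin m → Bool} → bitsToFin f ≡ bitsToFin g → ∀ k → f k ≡ g k
bitsToFin-injective {f = f} {g} f≡g k = begin
  f k                           ≡⟨ strictlyInverseˡ (f k) ⟨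
  to (from (f k))               ≡⟨ cong to (finToFun-funToFin (from ∘ f) k) ⟨
  to (finToFun (bitsToFin f) k) ≡⟨ cong (λ c → to (finToFun c k)) f≡g ⟩
  to (finToFun (bitsToFin g) k) ≡⟨ cong to (finToFun-funToFin (from ∘ g) k) ⟩
  to (from (g k))               ≡⟨ strictlyInverseˡ (g k) ⟩
  g k                           ∎
  where open ≡-Reasoning
        open Inverse 2↔Bool using (to; from; strictlyInverseˡ)

Unique-lookup-injective : ∀ {A : Set} {xs : List A} → Unique xs →
                          ∀ i j → List.lookup xs i ≡ List.lookup xs j → i ≡ j
Unique-lookup-injective (_ ∷ _) zero zero _ = refl
Unique-lookup-injective (x∉xs ∷ _) zero (suc j) x≡xⱼ =
  contradiction x≡xⱼ (All.lookup x∉xs (∈-lookup j))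
Unique-lookup-injective (x∉xs ∷ _) (suc i) zero xᵢ≡x =
  contradiction (sym xᵢ≡x) (All.lookup x∉xs (∈-lookup i))
Unique-lookup-injective (_ ∷ xs!) (suc i) (suc j) xᵢ≡xⱼ =
  cong suc (Unique-lookup-injective xs! i j xᵢ≡xⱼ)

length≤-injectiveOn : ∀ {A : Set} {xs : List A} {m} → Unique xs → (f : A → Fin m) →
                      (∀ {x y} → x ∈ xs → y ∈ xs → f x ≡ f y → x ≡ y) → length xs ≤ m
length≤-injectiveOn xs! f f-inj = injective⇒≤ λ {i} {j} fxᵢ≡fxⱼ →
  Unique-lookup-injective xs! i j (f-inj (∈-lookup i) (∈-lookup j) fxᵢ≡fxⱼ)

length-filter+∁ : ∀ {A : Set} {P : A → Set} (P? : Decidable P) xs →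
                  length (filter P? xs) + length (filter (∁? P?) xs) ≡ length xs
length-filter+∁ P? [] = refl
length-filter+∁ P? (x ∷ xs) with P? x
... | yes _ = cong suc (length-filter+∁ P? xs)
... | no  _ = trans (+-suc _ _) (cong suc (length-filter+∁ P? xs))

-- The one-dimensional billiard in [0, a] unfolded onto a circle of length 2a:
-- at phase r < a it is at r moving up (heading true), at phase a ≤ r < 2a it
-- is at 2a - r moving down.
phase : (a : ℕ) .{{_ : NonZero a}} → ℕ → ℕ
phase a t = _%_ t (2 * a) {{m*n≢0 2 a}}

heading : ℕ → ℕ → Bool
heading a r = r <ᵇ a

position : ℕ → ℕ → ℕ
position a r = if heading a r then r else 2 * a ∸ r

stateAtPhase : ℕ → ℕ → ℕ × Bool
stateAtPhase a r = position a r , heading a r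

bounce : ℕ → ℕ × Bool → ℕ × Bool
bounce a (p , d) = movePos p d , (if atWall a (movePos p d) then not d else d)

atWall-≡true : ∀ a {p} → p ≡ 0 ⊎ p ≡ a → atWall a p ≡ true
atWall-≡true a {p} p∈wall with (p ≟ 0) ⊎-dec (p ≟ a)
... | yes _     = refl
... | no p∉wall = contradiction p∈wall p∉wall

atWall-≡false : ∀ a {p} → p ≢ 0 → p ≢ a → atWall a p ≡ false
atWall-≡false a {p} p≢0 p≢a with (p ≟ 0) ⊎-dec (p ≟ a)
... | yes (inj₁ p≡0) = contradiction p≡0 p≢0
... | yes (inj₂ p≡a) = contradiction p≡a p≢a
... | no _           = refl

bounce-free : ∀ a {p d} → movePos p d ≢ 0 → movePos p d ≢ a → bounce a (p , d) ≡ (movePos p d , d)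
bounce-free a p'≢0 p'≢a rewrite atWall-≡false a p'≢0 p'≢a = refl

bounce-wall : ∀ a {p d} → movePos p d ≡ 0 ⊎ movePos p d ≡ a → bounce a (p , d) ≡ (movePos p d , not d)
bounce-wall a p'∈wall rewrite atWall-≡true a p'∈wall = refl

module _ {a : ℕ} .{{_ : NonZero a}} where

  private instance
    2a≢0 : NonZero (2 * a)
    2a≢0 = m*n≢0 2 a

  a<2a : a < 2 * a
  a<2a = subst (a <_) (*-comm a 2) (m<m*n a 2 ≤-refl)

  2a∸a≡a : 2 * a ∸ a ≡ a
  2a∸a≡a = trans (m+n∸m≡n a (a + 0)) (+-identityʳ a)

  phase<2a : ∀ t → phase a t < 2 * a
  phase<2a t = m%n<n t (2 * a)

  phase-suc : ∀ t → phase a (suc t) ≡ suc (phase a t) % (2 * a)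
  phase-suc t = begin
    (1 + t) % N             ≡⟨ %-distribˡ-+ 1 t N ⟩
    (1 % N + t % N) % N     ≡⟨ cong (λ r → (1 % N + r) % N) (m%n%n≡m%n t N) ⟨
    (1 % N + t % N % N) % N ≡⟨ %-distribˡ-+ 1 (t % N) N ⟨
    (1 + t % N) % N         ∎
    where open ≡-Reasoning
          N = 2 * a

  stateAtPhase-0 : stateAtPhase a 0 ≡ (0 , true)
  stateAtPhase-0 with 0 <ᵇ a | <ᵇ-reflects-< 0 a
  ... | true  | _       = refl
  ... | false | ofⁿ 0≮a = contradiction (>-nonZero⁻¹ a) 0≮a

  bounce-advance : ∀ {r} → suc r < 2 * a → bounce a (stateAtPhase a r) ≡ stateAtPhase a (suc r)
  bounce-advance {r} 1+r<2a with r <ᵇ a | <ᵇ-reflects-< r a | suc r <ᵇ a | <ᵇ-reflects-< (suc r) a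
  ... | true | _ | true | ofʸ 1+r<a = bounce-free a (λ ()) (<⇒≢ 1+r<a)
  ... | true | ofʸ r<a | false | ofⁿ 1+r≮a =
    trans (bounce-wall a (inj₂ 1+r≡a)) (cong (_, false) (begin
      suc r         ≡⟨ 1+r≡a ⟩
      a             ≡⟨ 2a∸a≡a ⟨
      2 * a ∸ a     ≡⟨ cong (2 * a ∸_) 1+r≡a ⟨
      2 * a ∸ suc r ∎))
    where open ≡-Reasoning
          1+r≡a = ≤-antisym r<a (≮⇒≥ 1+r≮a)
  ... | false | ofⁿ r≮a | true | ofʸ 1+r<a = contradiction (<-trans (n<1+n r) 1+r<a) r≮a
  ... | false | ofⁿ r≮a | false | _ =
    trans (bounce-free a {2 * a ∸ r} {false} (p'≢0 ∘ trans (sym p'≡)) (p'≢a ∘ trans (sym p'≡)))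
          (cong (_, false) p'≡)
    where
      p'≡ : 2 * a ∸ r ∸ 1 ≡ 2 * a ∸ suc r
      p'≡ = trans (∸-+-assoc (2 * a) r 1) (cong (2 * a ∸_) (+-comm r 1))
      p'≢0 : 2 * a ∸ suc r ≢ 0
      p'≢0 = m>n⇒m∸n≢0 {2 * a} {suc r} 1+r<2a
      p'≢a : 2 * a ∸ suc r ≢ a
      p'≢a e = r≮a (≤-reflexive (∸-cancelˡ-≡ (<⇒≤ 1+r<2a) (<⇒≤ a<2a) (trans e (sym 2a∸a≡a))))

  bounce-turn : ∀ {r} → suc r ≡ 2 * a → bounce a (stateAtPhase a r) ≡ stateAtPhase a 0
  bounce-turn {r} 1+r≡2a with r <ᵇ a | <ᵇ-reflects-< r a
  ... | true  | ofʸ r<a = contradiction (subst (_≤ a) 1+r≡2a r<a) (<⇒≱ a<2a)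
  ... | false | _       = trans (cong (λ p → bounce a (p , false)) 2a∸r≡1) (sym stateAtPhase-0)
    where 2a∸r≡1 : 2 * a ∸ r ≡ 1
          2a∸r≡1 = trans (cong (_∸ r) (sym 1+r≡2a)) (m+n∸n≡m 1 r)

  bounce-next : ∀ {r} → r < 2 * a → bounce a (stateAtPhase a r) ≡ stateAtPhase a (suc r % (2 * a))
  bounce-next {r} r<2a with m≤n⇒m<n∨m≡n r<2a
  ... | inj₁ 1+r<2a = trans (bounce-advance 1+r<2a) (cong (stateAtPhase a) (sym (m<n⇒m%n≡m 1+r<2a)))
  ... | inj₂ 1+r≡2a = trans (bounce-turn 1+r≡2a)
                            (cong (stateAtPhase a) (sym (trans (cong (_% (2 * a)) 1+r≡2a) (n%n≡0 (2 * a)))))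

  stateAtPhase-start : stateAtPhase a (phase a 0) ≡ (0 , true)
  stateAtPhase-start = trans (cong (stateAtPhase a) (m<n⇒m%n≡m (>-nonZero⁻¹ (2 * a)))) stateAtPhase-0

  bounce-phase : ∀ t → bounce a (stateAtPhase a (phase a t)) ≡ stateAtPhase a (phase a (suc t))
  bounce-phase t = trans (bounce-next (phase<2a t)) (cong (stateAtPhase a) (sym (phase-suc t)))

  position-heading-injective : ∀ {r r'} → r < 2 * a → r' < 2 * a →
                               position a r ≡ position a r' → heading a r ≡ heading a r' → r ≡ r'
  position-heading-injective {r} {r'} r<2a r'<2a p≡p' h≡h'
    with r <ᵇ a | <ᵇ-reflects-< r a | r' <ᵇ a | <ᵇ-reflects-< r' a
  ... | true  | _ | true  | _ = p≡p'
  ... | false | _ | false | _ = ∸-cancelˡ-≡ (<⇒≤ r<2a) (<⇒≤ r'<2a) p≡p'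
  ... | true  | _ | false | _ = contradiction h≡h' λ ()
  ... | false | _ | true  | _ = contradiction h≡h' λ ()

  position-reflect : ∀ {r r'} → r < 2 * a → r' < 2 * a →
                     position a r ≡ position a r' → heading a r ≢ heading a r' → r + r' ≡ 2 * a
  position-reflect {r} {r'} r<2a r'<2a p≡p' h≢h'
    with r <ᵇ a | <ᵇ-reflects-< r a | r' <ᵇ a | <ᵇ-reflects-< r' a
  ... | true  | _ | true  | _ = contradiction refl h≢h'
  ... | false | _ | false | _ = contradiction refl h≢h'
  ... | true  | _ | false | _ = trans (cong (_+ r') p≡p') (m∸n+n≡m (<⇒≤ r'<2a))
  ... | false | _ | true  | _ = trans (cong (r +_) (sym p≡p')) (m+[n∸m]≡n (<⇒≤ r<2a))

  position≡0 : ∀ {r} → r < 2 * a → position a r ≡ 0 → r ≡ 0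
  position≡0 {r} r<2a p≡0 with r <ᵇ a | <ᵇ-reflects-< r a
  ... | true  | _ = p≡0
  ... | false | _ = contradiction (m∸n≡0⇒m≤n p≡0) (<⇒≱ r<2a)

  position≡a : ∀ {r} → r < 2 * a → position a r ≡ a → r ≡ a
  position≡a {r} r<2a p≡a with r <ᵇ a | <ᵇ-reflects-< r a
  ... | true  | ofʸ r<a = contradiction p≡a (<⇒≢ r<a)
  ... | false | _       = ∸-cancelˡ-≡ (<⇒≤ r<2a) (<⇒≤ a<2a) (trans p≡a (sym 2a∸a≡a))

  phase-at-wall : ∀ {r w} → r < 2 * a → position a r ≡ w → w ≡ 0 ⊎ w ≡ a → r ≡ w
  phase-at-wall r<2a p≡0 (inj₁ refl) = position≡0 r<2a p≡0
  phase-at-wall r<2a p≡a (inj₂ refl) = position≡a r<2a p≡a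

  2a∣wall+wall : ∀ {w} → w ≡ 0 ⊎ w ≡ a → 2 * a ∣ w + w
  2a∣wall+wall (inj₁ refl) = (2 * a) ∣0
  2a∣wall+wall (inj₂ refl) = subst (2 * a ∣_) (cong (a +_) (+-identityʳ a)) ∣-refl

  ∣-below-2a : ∀ {r} → r < 2 * a → a ∣ r → r ≡ 0 ⊎ r ≡ a
  ∣-below-2a r<2a (divides zero r≡0) = inj₁ r≡0
  ∣-below-2a r<2a (divides 1 r≡a)    = inj₂ (trans r≡a (+-identityʳ a))
  ∣-below-2a r<2a (divides (suc (suc q)) r≡qa) =
    contradiction (subst (2 * a ≤_) (sym r≡qa) (*-monoˡ-≤ a (s≤s (s≤s (z≤n {q}))))) (<⇒≱ r<2a)

  position-a : position a a ≡ a
  position-a with a <ᵇ a | <ᵇ-reflects-< a a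
  ... | true  | ofʸ a<a = contradiction a<a (<-irrefl refl)
  ... | false | _       = 2a∸a≡a

  position-at-multiple : ∀ {t} → a ∣ t → position a (phase a t) ≡ 0 ⊎ position a (phase a t) ≡ a
  position-at-multiple {t} a∣t =
    Sum.map (λ r≡0 → trans (cong (position a) r≡0) (cong proj₁ stateAtPhase-0))
            (λ r≡a → trans (cong (position a) r≡a) position-a)
            (∣-below-2a (phase<2a t) a∣phase)
    where
      a∣phase : a ∣ phase a t
      a∣phase = m%n≡0⇒n∣m _ a (trans (m∣n⇒o%n%m≡o%m a (2 * a) t (n∣m*n 2)) (n∣m⇒m%n≡0 t a a∣t))

crossing≤-injectiveOn : ∀ {n} (a : Vec ℕ n) L v {m} (f : ℕ → Fin m) →
                        (∀ {t t'} → t ≤ L → t' ≤ L → γ a t ≡ v → γ a t' ≡ v → f t ≡ f t' → t ≡ t') →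
                        crossing a L v ≤ m
crossing≤-injectiveOn a L v f f-inj = length≤-injectiveOn (filter⁺ visit? (upTo⁺ (suc L))) f λ t∈ t'∈ →
  f-inj (proj₁ (visit⁻ t∈)) (proj₁ (visit⁻ t'∈)) (proj₂ (visit⁻ t∈)) (proj₂ (visit⁻ t'∈))
  where
    visit? : Decidable (λ t → γ a t ≡ v)
    visit? t = ≡-dec _≟_ (γ a t) v
    visit⁻ : ∀ {t} → t ∈ filter visit? (upTo (suc L)) → t ≤ L × γ a t ≡ v
    visit⁻ t∈ with t∈upTo , γt≡v ← ∈-filter⁻ visit? t∈ = s≤s⁻¹ (∈-upTo⁻ t∈upTo) , γt≡v

coordinate : ∀ {n} → State n → Fin n → ℕ × Bool
coordinate (p , d) i = lookup p i , lookup d i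

coordinate-step : ∀ {n} (a : Vec ℕ n) s i → coordinate (step a s) i ≡ bounce (lookup a i) (coordinate s i)
coordinate-step a (p , d) i
  rewrite lookup∘tabulate (λ k → if atWall (lookup a k) (lookup (zipWith movePos p d) k)
                                 then not (lookup d k) else lookup d k) i
        | lookup-zipWith movePos i p d = refl

OnWall : ∀ {n} → Vec ℕ n → Vec ℕ n → Fin n → Set
OnWall a v i = lookup v i ≡ 0 ⊎ lookup v i ≡ lookup a i

onWall? : ∀ {n} (a v : Vec ℕ n) → Decidable (OnWall a v)
onWall? a v i = (lookup v i ≟ 0) ⊎-dec (lookup v i ≟ lookup a i)

interior : ∀ {n} → Vec ℕ n → Vec ℕ n → List (Fin n)
interior {n} a v = filter (∁? (onWall? a v)) (allFin n)

length-interior : ∀ {n} (a v : Vec ℕ n) → cardI a v + length (interior a v) ≡ n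
length-interior {n} a v = trans (length-filter+∁ (onWall? a v) (allFin n)) (length-tabulate id)

∈-interior : ∀ {n} (a v : Vec ℕ n) {i} → ¬ OnWall a v i → i ∈ interior a v
∈-interior a v i∉wall = ∈-filter⁺ (∁? (onWall? a v)) (∈-allFin _) i∉wall

interior≡[]⇒corner : ∀ {n} (a v : Vec ℕ n) → interior a v ≡ [] → IsCorner a v
interior≡[]⇒corner a v ≡[] i with onWall? a v i
... | yes i∈wall = i∈wall
... | no  i∉wall with () ← subst (i ∈_) ≡[] (∈-interior a v i∉wall)

module _ {n} (a : Vec ℕ n) (a>0 : ∀ i → 0 < lookup a i) where

  private instance
    aᵢ≢0 : ∀ {i} → NonZero (lookup a i)
    aᵢ≢0 {i} = >-nonZero (a>0 i)
    2aᵢ≢0 : ∀ {i} → NonZero (2 * lookup a i)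
    2aᵢ≢0 {i} = m*n≢0 2 (lookup a i)

  phaseAt : Fin n → ℕ → ℕ
  phaseAt i = phase (lookup a i)

  headingAt : Fin n → ℕ → Bool
  headingAt i t = heading (lookup a i) (phaseAt i t)

  coordinate-state : ∀ t i → coordinate (state a t) i ≡ stateAtPhase (lookup a i) (phaseAt i t)
  coordinate-state zero i =
    trans (cong₂ _,_ (lookup-replicate i 0) (lookup-replicate i true)) (sym stateAtPhase-start)
  coordinate-state (suc t) i = begin
    coordinate (step a (state a t)) i         ≡⟨ coordinate-step a (state a t) i ⟩
    bounce aᵢ (coordinate (state a t) i)      ≡⟨ cong (bounce aᵢ) (coordinate-state t i) ⟩
    bounce aᵢ (stateAtPhase aᵢ (phase aᵢ t))  ≡⟨ bounce-phase t ⟩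
    stateAtPhase aᵢ (phase aᵢ (suc t))        ∎
    where open ≡-Reasoning
          aᵢ = lookup a i

  γ-position : ∀ t i → lookup (γ a t) i ≡ position (lookup a i) (phaseAt i t)
  γ-position t i = cong proj₁ (coordinate-state t i)

  γ-corner : ∀ {s} → (∀ i → lookup a i ∣ s) → IsCorner a (γ a s)
  γ-corner {s} aᵢ∣s i =
    Sum.map (trans (γ-position s i)) (trans (γ-position s i)) (position-at-multiple (aᵢ∣s i))

  position-at : ∀ {s v} → γ a s ≡ v → ∀ i → position (lookup a i) (phaseAt i s) ≡ lookup v i
  position-at {s} γs≡v i = trans (sym (γ-position s i)) (cong (λ w → lookup w i) γs≡v)

  phase-on-wall : ∀ {s v} → γ a s ≡ v → ∀ {i} → OnWall a v i → phaseAt i s ≡ lookup v i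
  phase-on-wall {s} γs≡v {i} i∈wall = phase-at-wall (phase<2a s) (position-at γs≡v i) i∈wall

  module _ {L} (stop : IsStopTime a L) where

    stopTime-minimal : ∀ {s} → (∀ i → lookup a i ∣ s) → s ≡ 0 ⊎ L ≤ s
    stopTime-minimal {s} aᵢ∣s with s ≟ 0 | s <? L
    ... | yes s≡0 | _       = inj₁ s≡0
    ... | no  _   | no s≮L  = inj₂ (≮⇒≥ s≮L)
    ... | no  s≢0 | yes s<L = contradiction (γ-corner aᵢ∣s) (proj₂ (proj₂ stop) s (n≢0⇒n>0 s≢0) s<L)

    common-multiple : Fin n → ∀ {m} → (∀ i → 2 * lookup a i ∣ m) → m ≡ 0 ⊎ 2 * L ≤ m
    common-multiple j {m} 2aᵢ∣m =
      Sum.map (λ m/2≡0 → trans m≡2[m/2] (cong (2 *_) m/2≡0))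
              (λ L≤m/2 → subst (2 * L ≤_) (sym m≡2[m/2]) (*-monoʳ-≤ 2 L≤m/2))
              (stopTime-minimal {m / 2} λ i → *-cancelˡ-∣ 2 (subst (2 * lookup a i ∣_) m≡2[m/2] (2aᵢ∣m i)))
      where
        m≡2[m/2] : m ≡ 2 * (m / 2)
        m≡2[m/2] = sym (m*[n/m]≡n (∣-trans (m∣m*n (lookup a j)) (2aᵢ∣m j)))

    in-phase⇒≥ : Fin n → ∀ {t t'} → (∀ i → phaseAt i t ≡ phaseAt i t') → t' < L → t' ≤ t
    in-phase⇒≥ j {t} {t'} ρ≡ρ' t'<L with common-multiple j (λ i → %-≡⇒∣∸ t t' (ρ≡ρ' i))
    ... | inj₁ t'∸t≡0  = m∸n≡0⇒m≤n t'∸t≡0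
    ... | inj₂ 2L≤t'∸t =
      contradiction (≤-trans 2L≤t'∸t (m∸n≤m t' t)) (<⇒≱ (<-≤-trans t'<L (m≤n*m L 2)))

    antiphase⇒⊥ : Fin n → ∀ {t t'} → (∀ i → 2 * lookup a i ∣ phaseAt i t + phaseAt i t') →
                  0 < t → t < L → t' < L → ⊥
    antiphase⇒⊥ j {t} {t'} 2aᵢ∣ρ+ρ' 0<t t<L t'<L
      with common-multiple j (λ i → ∣%+%⇒∣+ t t' (2aᵢ∣ρ+ρ' i))
    ... | inj₁ t+t'≡0  = contradiction (m+n≡0⇒m≡0 t t+t'≡0) (≢-nonZero⁻¹ t {{>-nonZero 0<t}})
    ... | inj₂ 2L≤t+t' = <⇒≱ (+-mono-< t<L (subst (t' <_) (sym (+-identityʳ L)) t'<L)) 2L≤t+t'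

    module _ {v} (v∉corner : ¬ IsCorner a v) where

      visit-inside : ∀ {t} → t ≤ L → γ a t ≡ v → 0 < t × t < L
      visit-inside {t} t≤L γt≡v = n≢0⇒n>0 t≢0 , ≤∧≢⇒< t≤L t≢L
        where
          t≢0 : t ≢ 0
          t≢0 refl = v∉corner (subst (IsCorner a) γt≡v λ i → inj₁ (lookup-replicate i 0))
          t≢L : t ≢ L
          t≢L refl = v∉corner (subst (IsCorner a) γt≡v (proj₁ (proj₂ stop)))

      module _ (j : Fin n) (F : List (Fin n)) (cover : ∀ i → ¬ OnWall a v i → i ∈ j ∷ F) where

        signature : ℕ → Fin (2 ^ length F)
        signature t = bitsToFin λ k → headingAt (List.lookup F k) t xor headingAt j t

        module _ {t t'} (γt≡v : γ a t ≡ v) (γt'≡v : γ a t' ≡ v) (sig≡ : signature t ≡ signature t') where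

          same-position : ∀ i → position (lookup a i) (phaseAt i t) ≡ position (lookup a i) (phaseAt i t')
          same-position i = trans (position-at γt≡v i) (sym (position-at γt'≡v i))

          relative-heading : ∀ {i} → i ∈ j ∷ F →
                             headingAt i t xor headingAt j t ≡ headingAt i t' xor headingAt j t'
          relative-heading (here refl) = trans (xor-same (headingAt j t)) (sym (xor-same (headingAt j t')))
          relative-heading (there i∈F) =
            subst (λ x → headingAt x t xor headingAt j t ≡ headingAt x t' xor headingAt j t')
                  (sym (lookup-index i∈F)) (bitsToFin-injective sig≡ (Any.index i∈F))

          in-phase : headingAt j t ≡ headingAt j t' → ∀ i → phaseAt i t ≡ phaseAt i t'
          in-phase hⱼ≡hⱼ' i with onWall? a v i
          ... | yes i∈wall = trans (phase-on-wall γt≡v i∈wall) (sym (phase-on-wall γt'≡v i∈wall))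
          ... | no  i∉wall = position-heading-injective (phase<2a t) (phase<2a t') (same-position i)
            (xor-cancelʳ _ _ _ (trans (relative-heading (cover i i∉wall))
                                      (cong (headingAt i t' xor_) (sym hⱼ≡hⱼ'))))

          antiphase : headingAt j t ≢ headingAt j t' → ∀ i → 2 * lookup a i ∣ phaseAt i t + phaseAt i t'
          antiphase hⱼ≢hⱼ' i with onWall? a v i
          ... | yes i∈wall =
            subst (2 * lookup a i ∣_)
                  (sym (cong₂ _+_ (phase-on-wall γt≡v i∈wall) (phase-on-wall γt'≡v i∈wall)))
                  (2a∣wall+wall i∈wall)
          ... | no  i∉wall =
            subst (2 * lookup a i ∣_)
                  (sym (position-reflect {lookup a i} (phase<2a t) (phase<2a t') (same-position i) hᵢ≢hᵢ'))
                  ∣-refl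
            where
              hᵢ≢hᵢ' : headingAt i t ≢ headingAt i t'
              hᵢ≢hᵢ' hᵢ≡hᵢ' = hⱼ≢hⱼ' (xor-cancelʳ _ _ (headingAt i t) (begin
                headingAt j t xor headingAt i t   ≡⟨ xor-comm (headingAt j t) (headingAt i t) ⟩
                headingAt i t xor headingAt j t   ≡⟨ relative-heading (cover i i∉wall) ⟩
                headingAt i t' xor headingAt j t' ≡⟨ xor-comm (headingAt i t') (headingAt j t') ⟩
                headingAt j t' xor headingAt i t' ≡⟨ cong (headingAt j t' xor_) hᵢ≡hᵢ' ⟨
                headingAt j t' xor headingAt i t  ∎))
                where open ≡-Reasoning

        signature-injective : ∀ {t t'} → t ≤ L → t' ≤ L → γ a t ≡ v → γ a t' ≡ v →
                              signature t ≡ signature t' → t ≡ t'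
        signature-injective {t} {t'} t≤L t'≤L γt≡v γt'≡v sig≡
          with visit-inside t≤L γt≡v | visit-inside t'≤L γt'≡v | headingAt j t Bool.≟ headingAt j t'
        ... | _ , t<L | _ , t'<L | yes hⱼ≡hⱼ' =
          ≤-antisym (in-phase⇒≥ j (sym ∘ ρ≡ρ') t<L) (in-phase⇒≥ j ρ≡ρ' t'<L)
          where ρ≡ρ' = in-phase γt≡v γt'≡v sig≡ hⱼ≡hⱼ'
        ... | 0<t , t<L | _ , t'<L | no hⱼ≢hⱼ' =
          ⊥-elim (antiphase⇒⊥ j (antiphase γt≡v γt'≡v sig≡ hⱼ≢hⱼ') 0<t t<L t'<L)

        crossing≤2^ : crossing a L v ≤ 2 ^ length F
        crossing≤2^ = crossing≤-injectiveOn a L v signature signature-injective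

lemma3 : (n : ℕ) (a : Vec ℕ n)
         → (∀ i → 0 < lookup a i)
         → (∀ (i j : Fin n) → i ≢ j → Coprime (lookup a i) (lookup a j))
         → (v : Vec ℕ n)
         → (∀ i → lookup v i ≤ lookup a i)
         → ¬ IsCorner a v
         → (L : ℕ) → IsStopTime a L
         → crossing a L v ≤ 2 ^ (n ∸ 1 ∸ cardI a v)
lemma3 n a a>0 _ v _ v∉corner L stop with interior a v in interior≡
... | [] = ⊥-elim (v∉corner (interior≡[]⇒corner a v interior≡))
... | j ∷ F = subst (λ k → crossing a L v ≤ 2 ^ k) |F|≡ (crossing≤2^ a a>0 stop v∉corner j F cover)
  where
    cover : ∀ i → ¬ OnWall a v i → i ∈ j ∷ F
    cover i i∉wall = subst (i ∈_) interior≡ (∈-interior a v i∉wall)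
    |F|≡ : length F ≡ n ∸ 1 ∸ cardI a v
    |F|≡ = m+[1+n]≡o⇒n≡o∸1∸m
             (trans (cong (λ is → cardI a v + length is) (sym interior≡)) (length-interior a v))
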